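{- CTL*CD is invariant under cycle-bisimulation: if $K_1=(AP,W_1,R_1,L_1,w_{I,1})$ and $K_2=(AP,W_2,R_2,L_2,w_{I,2})$ are Kripke structures and $B\subseteq W_1\times W_2$ is a cycle-bisimulation relation, then for every CTL*CD state formula $\varphi$ we have $K_1\models\varphi$ if and only if $K_2\models\varphi$.
   Context: Fix a finite set $AP$ of atomic propositions. A Kripke structure is $K=(AP,W,R,L,w_I)$ where $W$ is a countable non-empty set of worlds, $w_I\in W$ is the initial world, $R\subseteq W\times W$ is left-total, and $L:W\to 2^{AP}$. A path is an infinite sequence $\pi=\pi_0\pi_1\cdots$ of worlds with $(\pi_i,\pi_{i+1})\in R$ for all $i$; $\mathrm{Pth}(w)$ is the set of paths with $\pi_0=w$. A path $\pi$ is a cycle if for every $i$ there is $j>i$ with $\pi_j=\pi_0$; $\mathrm{Cyc}(w)$ is the set of cycles with $\pi_0=w$. CTL*CD state formulas $\phi$ and path formulas $\psi$: $\phi ::= p \mid \neg\phi\mid\phi\wedge\phi\mid\phi\vee\phi\mid \mathsf E\psi\mid\mathsf A\psi\mid \mathsf E^{\circlearrowleft}\psi\mid\mathsf A^{\circlearrowleft}\psi$ ($p\in AP$), $\psi::=\phi\mid\neg\psi\mid\psi\wedge\psi\mid\psi\vee\psi\mid \mathsf X\psi\mid\psi\,\mathsf U\,\psi$. Semantics: $K,w\models p$ iff $p\in L(w)$; Boolean connectives as usual; $\mathsf E\psi$ / $\mathsf A\psi$: some / every $\pi\in\mathrm{Pth}(w)$ satisfies $K,\pi,0\models\psi$; $\mathsf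 E^{\circlearrowleft}\psi$ / $\mathsf A^{\circlearrowleft}\psi$: some / every $\pi\in\mathrm{Cyc}(w)$ satisfies $K,\pi,0\models\psi$. For paths: $K,\pi,i\models\phi$ iff $K,\pi_i\models\phi$; Boolean connectives as usual; $K,\pi,i\models\mathsf X\psi$ iff $K,\pi,i+1\models\psi$; $K,\pi,i\models\psi_1\mathsf U\psi_2$ iff there is $k\in\mathbb N$ with $K,\pi,i+k\models\psi_2$ and $K,\pi,i+j\models\psi_1$ for all $0\le j<k$. $K\models\phi$ iff $K,w_I\models\phi$. A relation $B\subseteq W_1\times W_2$ is a cycle-bisimulation relation if (1) $(w_{I,1},w_{I,2})\in B$ and (2) for all $(w_1,w_2)\in B$: (a) $L_1(w_1)=L_2(w_2)$; (b) for every $v_1$ with $(w_1,v_1)\in R_1$ there is $v_2$ with $(w_2,v_2)\in R_2$ and $(v_1,v_2)\in B$; (c) for every $v_2$ with $(w_2,v_2)\in R_2$ there is $v_1$ with $(w_1,v_1)\in R_1$ and $(v_1,v_2)\in B$; (d) for every cycle $\pi_1$ of $K_1$ with $(\pi_1)_0=w_1$ there is a cycle $\pi_2$ of $K_2$ with $(\pi_2)_0=w_2$ and $((\pi_1)_i,(\pi_2)_i)\in B$ for all $i\in\mathbb N$; (e) symmetrically, for every cycle $\pi_2$ of $K_2$ with $(\pi_2)_0=w_2$ there is a cycle $\pi_1$ of $K_1$ with $(\pi_1)_0=w_1$ and $((\pi_1)_i,(\pi_2)_i)\in B$ for all $i$. -}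

module Defs where

open import Level using (0ℓ)
open import Data.Nat using (ℕ; suc; _+_; _<_)
open import Data.Fin using (Fin)
open import Data.Bool using (Bool; true)
open import Data.Product using (Σ; ∃; ∃-syntax; _×_; _,_)
open import Data.Sum using (_⊎_)
open import Data.Empty using (⊥)
open import Relation.Nullary using (¬_)
open import Relation.Binary.PropositionalEquality using (_≡_)
open import Function.Definitions using (Injective)

record Kripke (n : ℕ) : Set₁ where
  field
    W         : Set
    countable : Σ (W → ℕ) (λ f → Injective _≡_ _≡_ f)
    R         : W → W → Set
    L         : W → Fin n → Bool
    wI        : W
    leftTotal : ∀ w → ∃[ v ] R w v

module _ {n : ℕ} (K : Kripke n) where
  open Kripke K

  IsPath : (ℕ → W) → Set
  IsPath π = ∀ i → R (π i) (π (suc i))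

  PathFrom : W → (ℕ → W) → Set
  PathFrom w π = IsPath π × π 0 ≡ w

  IsCycle : (ℕ → W) → Set
  IsCycle π = IsPath π × (∀ i → ∃[ j ] (i < j × π j ≡ π 0))

  CycleFrom : W → (ℕ → W) → Set
  CycleFrom w π = IsCycle π × π 0 ≡ w

mutual
  data StateF (n : ℕ) : Set where
    atom  : Fin n → StateF n
    ¬ₛ_   : StateF n → StateF n
    _∧ₛ_  : StateF n → StateF n → StateF n
    _∨ₛ_  : StateF n → StateF n → StateF n
    E     : PathF n → StateF n
    A     : PathF n → StateF n
    Ecyc  : PathF n → StateF n
    Acyc  : PathF n → StateF n

  data PathF (n : ℕ) : Set where
    state : StateF n → PathF n
    ¬ₚ_   : PathF n → PathF n
    _∧ₚ_  : PathF n → PathF n → PathF n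
    _∨ₚ_  : PathF n → PathF n → PathF n
    X     : PathF n → PathF n
    _U_   : PathF n → PathF n → PathF n

module Sem {n : ℕ} (K : Kripke n) where
  open Kripke K

  mutual
    _⊨ₛ_ : W → StateF n → Set
    w ⊨ₛ atom p   = L w p ≡ true
    w ⊨ₛ (¬ₛ φ)   = ¬ (w ⊨ₛ φ)
    w ⊨ₛ (φ ∧ₛ ψ) = (w ⊨ₛ φ) × (w ⊨ₛ ψ)
    w ⊨ₛ (φ ∨ₛ ψ) = (w ⊨ₛ φ) ⊎ (w ⊨ₛ ψ)
    w ⊨ₛ E ψ      = ∃[ π ] (PathFrom K w π × ⊨ₚ π 0 ψ)
    w ⊨ₛ A ψ      = ∀ π → PathFrom K w π → ⊨ₚ π 0 ψ
    w ⊨ₛ Ecyc ψ   = ∃[ π ] (CycleFrom K w π × ⊨ₚ π 0 ψ)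
    w ⊨ₛ Acyc ψ   = ∀ π → CycleFrom K w π → ⊨ₚ π 0 ψ

    ⊨ₚ : (ℕ → W) → ℕ → PathF n → Set
    ⊨ₚ π i (state φ) = π i ⊨ₛ φ
    ⊨ₚ π i (¬ₚ ψ)    = ¬ (⊨ₚ π i ψ)
    ⊨ₚ π i (ψ ∧ₚ χ)  = ⊨ₚ π i ψ × ⊨ₚ π i χ
    ⊨ₚ π i (ψ ∨ₚ χ)  = ⊨ₚ π i ψ ⊎ ⊨ₚ π i χ
    ⊨ₚ π i (X ψ)     = ⊨ₚ π (suc i) ψ
    ⊨ₚ π i (ψ U χ)   = ∃[ k ] (⊨ₚ π (i + k) χ × (∀ j → j < k → ⊨ₚ π (i + j) ψ))

_⊨_ : {n : ℕ} → Kripke n → StateF n → Set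
K ⊨ φ = Sem._⊨ₛ_ K (Kripke.wI K) φ

record IsCycleBisim {n : ℕ} (K₁ K₂ : Kripke n)
       (B : Kripke.W K₁ → Kripke.W K₂ → Set) : Set where
  private
    module K₁ = Kripke K₁
    module K₂ = Kripke K₂
  field
    init   : B K₁.wI K₂.wI
    label  : ∀ {w₁ w₂} → B w₁ w₂ → ∀ p → K₁.L w₁ p ≡ K₂.L w₂ p
    forth  : ∀ {w₁ w₂} → B w₁ w₂ → ∀ v₁ → K₁.R w₁ v₁ → ∃[ v₂ ] (K₂.R w₂ v₂ × B v₁ v₂)
    back   : ∀ {w₁ w₂} → B w₁ w₂ → ∀ v₂ → K₂.R w₂ v₂ → ∃[ v₁ ] (K₁.R w₁ v₁ × B v₁ v₂)
    cycForth : ∀ {w₁ w₂} → B w₁ w₂ → ∀ π₁ → CycleFrom K₁ w₁ π₁ →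
               ∃[ π₂ ] (CycleFrom K₂ w₂ π₂ × (∀ i → B (π₁ i) (π₂ i)))
    cycBack  : ∀ {w₁ w₂} → B w₁ w₂ → ∀ π₂ → CycleFrom K₂ w₂ π₂ →
               ∃[ π₁ ] (CycleFrom K₁ w₁ π₁ × (∀ i → B (π₁ i) (π₂ i)))

-- By simultaneous induction on formulas, B-related worlds satisfy the same state
-- formulas and paths related pointwise by B the same path formulas. For E and A,
-- the forth and back conditions lift a path on one side step by step to a
-- pointwise related path on the other. Such a step-by-step lift of a cycle need
-- not return to its start, so for Ecyc and Acyc the cycle conditions (d) and (e)
-- are needed instead.
module Submission where

open import Defs
open import Data.Empty using (⊥)
open import Data.Nat using (ℕ; zero; suc; _+_; _<_)
open import Data.Product using (Σ; ∃-syntax; _×_; _,_; proj₁; proj₂; map; map₂)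
open import Data.Product.Function.NonDependent.Propositional using (_×-⇔_)
open import Data.Sum.Function.Propositional using (_⊎-⇔_)
open import Function.Bundles using (_⇔_; mk⇔; Equivalence)
open import Function.Construct.Identity using (⇔-id)
open import Function.Related.TypeIsomorphisms using (→-cong-⇔)
open import Relation.Binary.PropositionalEquality using (refl; sym; trans)

open Equivalence

Lockstep : ∀ {a b} {A : Set a} {B : Set b} → (A → B → Set) → (ℕ → A) → (ℕ → B) → Set
Lockstep _∼_ π₁ π₂ = ∀ i → π₁ i ∼ π₂ i

¬-⇔ : ∀ {P Q : Set} → P ⇔ Q → (P → ⊥) ⇔ (Q → ⊥)
¬-⇔ P⇔Q = →-cong-⇔ P⇔Q (⇔-id ⊥)

until-⇔ : ∀ {P P′ Q Q′ : ℕ → Set} → (∀ j → P j ⇔ P′ j) → (∀ k → Q k ⇔ Q′ k) →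
          (∃[ k ] (Q k × ∀ j → j < k → P j)) ⇔ (∃[ k ] (Q′ k × ∀ j → j < k → P′ j))
until-⇔ P⇔P′ Q⇔Q′ = mk⇔
  (map₂ (map (to   (Q⇔Q′ _)) λ before j j<k → to   (P⇔P′ j) (before j j<k)))
  (map₂ (map (from (Q⇔Q′ _)) λ before j j<k → from (P⇔P′ j) (before j j<k)))

module _ {a b} {X : Set a} {Y : Set b} {P : X → Set} {Q : Y → Set} {Rel : X → Y → Set}
         (forth : ∀ {x} → P x → ∃[ y ] (Q y × Rel x y))
         (back  : ∀ {y} → Q y → ∃[ x ] (P x × Rel x y))
         {F : X → Set} {G : Y → Set} (F⇔G : ∀ {x y} → Rel x y → F x ⇔ G y) where

  ∃-cong-bitotal : (∃[ x ] (P x × F x)) ⇔ (∃[ y ] (Q y × G y))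
  ∃-cong-bitotal = mk⇔
    (λ (x , px , fx) → let (y , qy , r) = forth px in y , qy , to (F⇔G r) fx)
    (λ (y , qy , gy) → let (x , px , r) = back qy in x , px , from (F⇔G r) gy)

  ∀-cong-bitotal : (∀ x → P x → F x) ⇔ (∀ y → Q y → G y)
  ∀-cong-bitotal = mk⇔
    (λ f y qy → let (x , px , r) = back qy in to (F⇔G r) (f x px))
    (λ g x px → let (y , qy , r) = forth px in from (F⇔G r) (g y qy))

module _ {n : ℕ} (K₁ K₂ : Kripke n) {B : Kripke.W K₁ → Kripke.W K₂ → Set} where
  private
    module K₁ = Kripke K₁
    module K₂ = Kripke K₂

  lift-path : (∀ {w₁ w₂} → B w₁ w₂ → ∀ v₁ → K₁.R w₁ v₁ → ∃[ v₂ ] (K₂.R w₂ v₂ × B v₁ v₂)) →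
              ∀ {w₁ w₂} → B w₁ w₂ → ∀ {π₁} → PathFrom K₁ w₁ π₁ →
              ∃[ π₂ ] (PathFrom K₂ w₂ π₂ × Lockstep B π₁ π₂)
  lift-path forth {w₂ = w₂} b {π₁} (isPath , refl) =
    (λ i → proj₁ (related i)) , (step , refl) , (λ i → proj₂ (related i))
    where
    related : ∀ i → Σ K₂.W (B (π₁ i))
    related zero    = w₂ , b
    related (suc i) = map₂ proj₂ (forth (proj₂ (related i)) _ (isPath i))

    step : ∀ i → K₂.R (proj₁ (related i)) (proj₁ (related (suc i)))
    step i = proj₁ (proj₂ (forth (proj₂ (related i)) _ (isPath i)))

module _ {n : ℕ} {K₁ K₂ : Kripke n} {B : Kripke.W K₁ → Kripke.W K₂ → Set}
         (bisim : IsCycleBisim K₁ K₂ B) where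
  open IsCycleBisim bisim
  open Sem K₁ renaming (_⊨ₛ_ to _⊨₁_; ⊨ₚ to ⊨₁ₚ)
  open Sem K₂ renaming (_⊨ₛ_ to _⊨₂_; ⊨ₚ to ⊨₂ₚ)

  path-forth : ∀ {w₁ w₂} → B w₁ w₂ → ∀ {π₁} → PathFrom K₁ w₁ π₁ →
               ∃[ π₂ ] (PathFrom K₂ w₂ π₂ × Lockstep B π₁ π₂)
  path-forth = lift-path K₁ K₂ forth

  path-back : ∀ {w₁ w₂} → B w₁ w₂ → ∀ {π₂} → PathFrom K₂ w₂ π₂ →
              ∃[ π₁ ] (PathFrom K₁ w₁ π₁ × Lockstep B π₁ π₂)
  path-back = lift-path K₂ K₁ back

  cycle-forth : ∀ {w₁ w₂} → B w₁ w₂ → ∀ {π₁} → CycleFrom K₁ w₁ π₁ →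
                ∃[ π₂ ] (CycleFrom K₂ w₂ π₂ × Lockstep B π₁ π₂)
  cycle-forth b = cycForth b _

  cycle-back : ∀ {w₁ w₂} → B w₁ w₂ → ∀ {π₂} → CycleFrom K₂ w₂ π₂ →
               ∃[ π₁ ] (CycleFrom K₁ w₁ π₁ × Lockstep B π₁ π₂)
  cycle-back b = cycBack b _

  mutual
    state-formula-invariant : ∀ {w₁ w₂} → B w₁ w₂ → ∀ φ → (w₁ ⊨₁ φ) ⇔ (w₂ ⊨₂ φ)
    state-formula-invariant b (atom p) = mk⇔ (trans (sym (label b p))) (trans (label b p))
    state-formula-invariant b (¬ₛ φ)   = ¬-⇔ (state-formula-invariant b φ)
    state-formula-invariant b (φ ∧ₛ χ) = state-formula-invariant b φ ×-⇔ state-formula-invariant b χ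
    state-formula-invariant b (φ ∨ₛ χ) = state-formula-invariant b φ ⊎-⇔ state-formula-invariant b χ
    state-formula-invariant b (E ψ)    =
      ∃-cong-bitotal (path-forth b) (path-back b) (λ bb → path-formula-invariant bb ψ 0)
    state-formula-invariant b (A ψ)    =
      ∀-cong-bitotal (path-forth b) (path-back b) (λ bb → path-formula-invariant bb ψ 0)
    state-formula-invariant b (Ecyc ψ) =
      ∃-cong-bitotal (cycle-forth b) (cycle-back b) (λ bb → path-formula-invariant bb ψ 0)
    state-formula-invariant b (Acyc ψ) =
      ∀-cong-bitotal (cycle-forth b) (cycle-back b) (λ bb → path-formula-invariant bb ψ 0)

    path-formula-invariant : ∀ {π₁ π₂} → Lockstep B π₁ π₂ → ∀ ψ i → ⊨₁ₚ π₁ i ψ ⇔ ⊨₂ₚ π₂ i ψ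
    path-formula-invariant bb (state φ) i = state-formula-invariant (bb i) φ
    path-formula-invariant bb (¬ₚ ψ)    i = ¬-⇔ (path-formula-invariant bb ψ i)
    path-formula-invariant bb (ψ ∧ₚ χ)  i = path-formula-invariant bb ψ i ×-⇔ path-formula-invariant bb χ i
    path-formula-invariant bb (ψ ∨ₚ χ)  i = path-formula-invariant bb ψ i ⊎-⇔ path-formula-invariant bb χ i
    path-formula-invariant bb (X ψ)     i = path-formula-invariant bb ψ (suc i)
    path-formula-invariant bb (ψ U χ)   i =
      until-⇔ (λ j → path-formula-invariant bb ψ (i + j)) (λ k → path-formula-invariant bb χ (i + k))

mainTheorem2 : {n : ℕ} (K₁ K₂ : Kripke n) (B : Kripke.W K₁ → Kripke.W K₂ → Set) →
               IsCycleBisim K₁ K₂ B → (φ : StateF n) → (K₁ ⊨ φ) ⇔ (K₂ ⊨ φ)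
mainTheorem2 K₁ K₂ B bisim φ = state-formula-invariant bisim (IsCycleBisim.init bisim) φ
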